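{- Every nonzero vector $v\in\mathbb{Z}[i]^4$ (i.e. every $1$-icube in $\mathbb{Z}[i]^4$) can be extended to a $4$-icube in $\mathbb{Z}[i]^4$.
   Context: For a complex matrix $M$, $M^*=\overline{M}^T$. For $1\leq k\leq n$, a matrix $(v_1|\dots|v_k)\in\mathbb{Z}[i]^{n\times k}$ is a $k$-icube in $\mathbb{Z}[i]^n$ of norm $\lambda>0$ if $v_i^*v_j=\lambda$ for $i=j$ and $v_i^*v_j=0$ for $i\neq j$; a nonzero vector alone is a $1$-icube. For $\ell<k$, an $\ell$-icube $A$ can be extended to a $k$-icube if some $\ell$ columns of some $k$-icube form $A$. -}

module Defs where

open import Data.Nat using (ℕ; suc; _<_)
open import Data.Integer as ℤ using (ℤ; 0ℤ; +_)
open import Data.Fin as Fin using (Fin)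
open import Data.Product using (_×_; _,_; Σ; ∃)
open import Relation.Binary.PropositionalEquality using (_≡_)
open import Relation.Nullary using (¬_)

-- Gaussian integers a + b i represented as pairs (a , b) of integers.
ℤ[i] : Set
ℤ[i] = ℤ × ℤ

0ᵍ : ℤ[i]
0ᵍ = (0ℤ , 0ℤ)

ι : ℤ → ℤ[i]
ι a = (a , 0ℤ)

_+ᵍ_ : ℤ[i] → ℤ[i] → ℤ[i]
(a , b) +ᵍ (c , d) = (a ℤ.+ c , b ℤ.+ d)

_*ᵍ_ : ℤ[i] → ℤ[i] → ℤ[i]
(a , b) *ᵍ (c , d) = (a ℤ.* c ℤ.- b ℤ.* d , a ℤ.* d ℤ.+ b ℤ.* c)

conj : ℤ[i] → ℤ[i]
conj (a , b) = (a , ℤ.- b)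

Σᵍ : (n : ℕ) → (Fin n → ℤ[i]) → ℤ[i]
Σᵍ 0 f = 0ᵍ
Σᵍ (suc n) f = f Fin.zero +ᵍ Σᵍ n (λ j → f (Fin.suc j))

Vecᵍ : ℕ → Set
Vecᵍ n = Fin n → ℤ[i]

_⋆_ : {n : ℕ} → Vecᵍ n → Vecᵍ n → ℤ[i]
_⋆_ {n} v w = Σᵍ n (λ j → conj (v j) *ᵍ w j)

-- n × k matrices over ℤ[i], given by their k columns
Matᵍ : ℕ → ℕ → Set
Matᵍ n k = Fin k → Vecᵍ n

IsIcube : (n k : ℕ) → Matᵍ n k → ℕ → Set
IsIcube n k M λ′ =
  (0 < λ′) ×
  (∀ i → (M i ⋆ M i) ≡ ι (+ λ′)) ×
  (∀ i j → ¬ (i ≡ j) → (M i ⋆ M j) ≡ 0ᵍ)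

Icube : (n k : ℕ) → Matᵍ n k → Set
Icube n k M = Σ ℕ (λ λ′ → IsIcube n k M λ′)

Nonzero : {n : ℕ} → Vecᵍ n → Set
Nonzero v = ¬ (∀ j → v j ≡ 0ᵍ)

ExtendsVec : (n k : ℕ) → Vecᵍ n → Set
ExtendsVec n k v = Σ (Matᵍ n k) (λ M → Icube n k M × Σ (Fin k) (λ c → ∀ j → M c j ≡ v j))

-- Write ℤ[i]⁴ as ℍ², where ℍ = ℤ[i] ⊕ ℤ[i] j are the Lipschitz quaternions (j z = z̄ j), and let
-- J be left multiplication by j. For u = (a , c) and w = (b , d) the quaternion
-- ⟪ u , w ⟫ = b ā + d c̄ has complex part u* w and j-part (J u)* w, and the two remaining inner
-- products among u, J u, w, J w are conjugates of these. Hence (u , J u , w , J w) is a 4-icube of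
-- norm N a + N c as soon as b ā + d c̄ = 0, N b = N c and N d = N a. Such a w is found by a
-- Euclidean descent on N a + N c: if N a = N c take w = (- a , c), if a = 0 take w = (c , 0);
-- if, say, 0 < N a < N c, rounding ā c / N a componentwise gives t with N (c - a t) ≤ N a, and a
-- solution (b , d) for (a , c - a t) becomes the solution (b - d t̄ , d) for (a , c); N b = N c
-- then follows from the multiplicativity of N.
module Submission where

open import Algebra.Bundles.Raw using (RawRing)
open import Data.Empty using (⊥-elim)
open import Data.Fin.Base using (Fin; _↑ʳ_)
open import Data.Fin.Patterns using (0F; 1F; 2F; 3F)
open import Data.Integer.Base as ℤ using (ℤ; 0ℤ; 1ℤ; +_)
open import Data.Integer.DivMod using (_/ℕ_; _%ℕ_; a≡a%ℕn+[a/ℕn]*n; n%ℕd<d)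
import Data.Integer.Properties as ℤ
open import Data.Integer.Tactic.RingSolver using (ring; solve-∀)
open import Data.Nat.Base as ℕ using (ℕ; _<_; _≤_; NonZero)
open import Data.Nat.Induction using (<-wellFounded)
import Data.Nat.Properties as ℕ
open import Data.Nat.Tactic.RingSolver using () renaming (solve-∀ to ℕ-solve-∀)
open import Data.Product.Base using (_×_; _,_; Σ; ∃₂; proj₁; proj₂)
open import Data.Sum.Base using (reduce)
open import Data.Vec.Base using (Vec; []; _∷_; _++_)
open import Induction.WellFounded using (Acc; acc)
open import Level using (0ℓ)
open import Relation.Binary.Definitions using (tri<; tri≈; tri>)
open import Relation.Binary.PropositionalEquality
  using (_≡_; refl; sym; trans; cong; cong₂; subst; module ≡-Reasoning)
open import Relation.Nullary using (¬_; yes; no)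
open import Tactic.RingSolver.Core.Expression using (Expr; Κ; Ι; _⊕_; _⊗_; ⊝_)
import Tactic.RingSolver.NonReflective ring as Solver

open import Defs

-- (z , w) : ℍ stands for z + w j; J q = j q.
module Quaternions {c ℓ} (R : RawRing c ℓ) where
  open RawRing R using (Carrier; _+_; _*_; -_; 0#)

  infixl 6 _+ᶜ_ _+ʰ_ _-ʰ_
  infixl 7 _*ᶜ_ _*ʰ_ _∙_

  ℂ : Set c
  ℂ = Carrier × Carrier

  0ᶜ : ℂ
  0ᶜ = (0# , 0#)

  -ᶜ_ conjᶜ : ℂ → ℂ
  -ᶜ (a , b) = (- a , - b)
  conjᶜ (a , b) = (a , - b)

  _+ᶜ_ _*ᶜ_ : ℂ → ℂ → ℂ
  (a , b) +ᶜ (c , d) = (a + c , b + d)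
  (a , b) *ᶜ (c , d) = (a * c + - (b * d) , a * d + b * c)

  ℍ : Set c
  ℍ = ℂ × ℂ

  0ʰ : ℍ
  0ʰ = (0ᶜ , 0ᶜ)

  real : Carrier → ℍ
  real s = ((s , 0#) , 0ᶜ)

  -ʰ_ conjʰ J : ℍ → ℍ
  -ʰ (z , w) = (-ᶜ z , -ᶜ w)
  conjʰ (z , w) = (conjᶜ z , -ᶜ w)
  J (z , w) = (-ᶜ conjᶜ w , conjᶜ z)

  _+ʰ_ _-ʰ_ _*ʰ_ : ℍ → ℍ → ℍ
  (z , w) +ʰ (z′ , w′) = (z +ᶜ z′ , w +ᶜ w′)
  x -ʰ y = x +ʰ -ʰ y
  (z , w) *ʰ (z′ , w′) = (z *ᶜ z′ +ᶜ -ᶜ (w *ᶜ conjᶜ w′) , z *ᶜ w′ +ᶜ w *ᶜ conjᶜ z′)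

  _∙_ : Carrier → ℍ → ℍ
  s ∙ ((a , b) , (c , d)) = ((s * a , s * b) , (s * c , s * d))

  N : ℍ → Carrier
  N ((a , b) , (c , d)) = (a * a + b * b) + (c * c + d * d)

  J₂ : ℍ × ℍ → ℍ × ℍ
  J₂ (a , c) = (J a , J c)

  ⟪_,_⟫ : ℍ × ℍ → ℍ × ℍ → ℍ
  ⟪ (a , c) , (b , d) ⟫ = b *ʰ conjʰ a +ʰ d *ʰ conjʰ c

  -- The Hermitian form of ℂ⁴, bracketed exactly as the sum Σᵍ 4 in col u ⋆ col v unfolds.
  _·_ : ℍ × ℍ → ℍ × ℍ → ℂ
  ((z₁ , w₁) , (z₂ , w₂)) · ((z₁′ , w₁′) , (z₂′ , w₂′)) =
    conjᶜ z₁ *ᶜ z₁′ +ᶜ (conjᶜ w₁ *ᶜ w₁′ +ᶜ (conjᶜ z₂ *ᶜ z₂′ +ᶜ (conjᶜ w₂ *ᶜ w₂′ +ᶜ 0ᶜ)))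

open Quaternions ℤ.+-*-rawRing

col : ℍ × ℍ → Vecᵍ 4
col ((z , _) , _) 0F = z
col ((_ , w) , _) 1F = w
col (_ , (z , _)) 2F = z
col (_ , (_ , w)) 3F = w

Expr-rawRing : ℕ → RawRing 0ℓ 0ℓ
Expr-rawRing n = record
  { Carrier = Expr ℤ n ; _≈_ = _≡_ ; _+_ = _⊕_ ; _*_ = _⊗_ ; -_ = ⊝_ ; 0# = Κ 0ℤ ; 1# = Κ 1ℤ }

-- Instantiated at solver expressions, the quaternion operations build syntax trees whose
-- evaluation is definitionally the integer operation; an identity of quaternions is then
-- proved by normalising its integer components.
module E {n} = Quaternions (Expr-rawRing n)

open Solver.Ops using (⟦_⟧; ⟦_⇓⟧; prove)

⟦_⟧ᶜ ⟦_⇓⟧ᶜ : ∀ {n} → E.ℂ {n} → Vec ℤ n → ℤ[i]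
⟦ (x , y) ⟧ᶜ ρ = (⟦ x ⟧ ρ , ⟦ y ⟧ ρ)
⟦ (x , y) ⇓⟧ᶜ ρ = (⟦ x ⇓⟧ ρ , ⟦ y ⇓⟧ ρ)

⟦_⟧ʰ ⟦_⇓⟧ʰ : ∀ {n} → E.ℍ {n} → Vec ℤ n → ℍ
⟦ (z , w) ⟧ʰ ρ = (⟦ z ⟧ᶜ ρ , ⟦ w ⟧ᶜ ρ)
⟦ (z , w) ⇓⟧ʰ ρ = (⟦ z ⇓⟧ᶜ ρ , ⟦ w ⇓⟧ᶜ ρ)

ℂ-identity : ∀ {n} (ρ : Vec ℤ n) (x y : E.ℂ) → ⟦ x ⇓⟧ᶜ ρ ≡ ⟦ y ⇓⟧ᶜ ρ → ⟦ x ⟧ᶜ ρ ≡ ⟦ y ⟧ᶜ ρ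
ℂ-identity ρ (x₁ , x₂) (y₁ , y₂) eq =
  cong₂ _,_ (prove ρ x₁ y₁ (cong proj₁ eq)) (prove ρ x₂ y₂ (cong proj₂ eq))

ℍ-identity : ∀ {n} (ρ : Vec ℤ n) (x y : E.ℍ) → ⟦ x ⇓⟧ʰ ρ ≡ ⟦ y ⇓⟧ʰ ρ → ⟦ x ⟧ʰ ρ ≡ ⟦ y ⟧ʰ ρ
ℍ-identity ρ (x₁ , x₂) (y₁ , y₂) eq =
  cong₂ _,_ (ℂ-identity ρ x₁ y₁ (cong proj₁ eq)) (ℂ-identity ρ x₂ y₂ (cong proj₂ eq))

⟨_⟩ : ℍ → Vec ℤ 4
⟨ ((a , b) , (c , d)) ⟩ = a ∷ b ∷ c ∷ d ∷ []

-- The m-th quaternion variable, i.e. solver variables 4m … 4m+3 of an environment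
-- ⟨ x₀ ⟩ ++ ⟨ x₁ ⟩ ++ ⋯.
var : ∀ {n} (m : ℕ) → E.ℍ {m ℕ.* 4 ℕ.+ (4 ℕ.+ n)}
var {n} m = ((v 0F , v 1F) , (v 2F , v 3F))
  where
  v : Fin (4 ℕ.+ n) → Expr ℤ (m ℕ.* 4 ℕ.+ (4 ℕ.+ n))
  v i = Ι (m ℕ.* 4 ↑ʳ i)

⋆-col-col : ∀ u v → col u ⋆ col v ≡ proj₁ ⟪ u , v ⟫
⋆-col-col (a , c) (b , d) = ℂ-identity (⟨ a ⟩ ++ ⟨ c ⟩ ++ ⟨ b ⟩ ++ ⟨ d ⟩)
  ((var 0 , var 1) E.· (var 2 , var 3)) (proj₁ E.⟪ (var 0 , var 1) , (var 2 , var 3) ⟫) refl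

⋆-J-col : ∀ u v → col (J₂ u) ⋆ col v ≡ proj₂ ⟪ u , v ⟫
⋆-J-col (a , c) (b , d) = ℂ-identity (⟨ a ⟩ ++ ⟨ c ⟩ ++ ⟨ b ⟩ ++ ⟨ d ⟩)
  (E.J₂ (var 0 , var 1) E.· (var 2 , var 3)) (proj₂ E.⟪ (var 0 , var 1) , (var 2 , var 3) ⟫) refl

⋆-col-J : ∀ u v → col u ⋆ col (J₂ v) ≡ -ᶜ conjᶜ (proj₂ ⟪ u , v ⟫)
⋆-col-J (a , c) (b , d) = ℂ-identity (⟨ a ⟩ ++ ⟨ c ⟩ ++ ⟨ b ⟩ ++ ⟨ d ⟩)
  ((var 0 , var 1) E.· E.J₂ (var 2 , var 3))
  (E.-ᶜ E.conjᶜ (proj₂ E.⟪ (var 0 , var 1) , (var 2 , var 3) ⟫)) refl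

⋆-J-J : ∀ u v → col (J₂ u) ⋆ col (J₂ v) ≡ conjᶜ (proj₁ ⟪ u , v ⟫)
⋆-J-J (a , c) (b , d) = ℂ-identity (⟨ a ⟩ ++ ⟨ c ⟩ ++ ⟨ b ⟩ ++ ⟨ d ⟩)
  (E.J₂ (var 0 , var 1) E.· E.J₂ (var 2 , var 3))
  (E.conjᶜ (proj₁ E.⟪ (var 0 , var 1) , (var 2 , var 3) ⟫)) refl

N-* : ∀ x y → N (x *ʰ y) ≡ N x ℤ.* N y
N-* x y = prove (⟨ x ⟩ ++ ⟨ y ⟩) (E.N (var 0 E.*ʰ var 1)) (E.N (var 0) ⊗ E.N (var 1)) refl

N-conj : ∀ x → N (conjʰ x) ≡ N x
N-conj x = prove ⟨ x ⟩ (E.N (E.conjʰ (var 0))) (E.N (var 0)) refl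

N-neg : ∀ x → N (-ʰ x) ≡ N x
N-neg x = prove ⟨ x ⟩ (E.N (E.-ʰ var 0)) (E.N (var 0)) refl

+ʰ-comm : ∀ x y → x +ʰ y ≡ y +ʰ x
+ʰ-comm x y = ℍ-identity (⟨ x ⟩ ++ ⟨ y ⟩) (var 0 E.+ʰ var 1) (var 1 E.+ʰ var 0) refl

+ʰ-cancelˡ : ∀ x y → (x +ʰ y) -ʰ x ≡ y
+ʰ-cancelˡ x y = ℍ-identity (⟨ x ⟩ ++ ⟨ y ⟩) ((var 0 E.+ʰ var 1) E.-ʰ var 0) (var 1) refl

+ʰ≡0ʰ⇒≡-ʰ : ∀ x y → x +ʰ y ≡ 0ʰ → x ≡ -ʰ y
+ʰ≡0ʰ⇒≡-ʰ x y x+y≡0 = begin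
  x                ≡⟨ ℍ-identity (⟨ x ⟩ ++ ⟨ y ⟩) (var 0) ((var 0 E.+ʰ var 1) E.-ʰ var 1) refl ⟩
  (x +ʰ y) -ʰ y    ≡⟨ cong (_-ʰ y) x+y≡0 ⟩
  0ʰ -ʰ y          ≡⟨ ℍ-identity ⟨ y ⟩ (E.0ʰ E.-ʰ var 0) (E.-ʰ var 0) refl ⟩
  -ʰ y             ∎
  where open ≡-Reasoning

ā*[c-a*t]≡ā*c-Na∙t : ∀ a c t → conjʰ a *ʰ (c -ʰ a *ʰ t) ≡ conjʰ a *ʰ c -ʰ N a ∙ t
ā*[c-a*t]≡ā*c-Na∙t a c t = ℍ-identity (⟨ a ⟩ ++ ⟨ c ⟩ ++ ⟨ t ⟩)
  (E.conjʰ (var 0) E.*ʰ (var 1 E.-ʰ var 0 E.*ʰ var 2))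
  (E.conjʰ (var 0) E.*ʰ var 1 E.-ʰ E.N (var 0) E.∙ var 2) refl

⟪⟫-conj-sym : ∀ u v → ⟪ v , u ⟫ ≡ conjʰ ⟪ u , v ⟫
⟪⟫-conj-sym (a , c) (b , d) = ℍ-identity (⟨ a ⟩ ++ ⟨ c ⟩ ++ ⟨ b ⟩ ++ ⟨ d ⟩)
  E.⟪ (var 2 , var 3) , (var 0 , var 1) ⟫ (E.conjʰ E.⟪ (var 0 , var 1) , (var 2 , var 3) ⟫) refl

⟪⟫-self : ∀ a c → ⟪ (a , c) , (a , c) ⟫ ≡ real (N a ℤ.+ N c)
⟪⟫-self a c = ℍ-identity (⟨ a ⟩ ++ ⟨ c ⟩)
  E.⟪ (var 0 , var 1) , (var 0 , var 1) ⟫ (E.real (E.N (var 0) ⊕ E.N (var 1))) refl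

⟪⟫-neg : ∀ a c → ⟪ (a , c) , (-ʰ a , c) ⟫ ≡ real (N c ℤ.- N a)
⟪⟫-neg a c = ℍ-identity (⟨ a ⟩ ++ ⟨ c ⟩)
  E.⟪ (var 0 , var 1) , (E.-ʰ var 0 , var 1) ⟫ (E.real (E.N (var 1) ⊕ ⊝ E.N (var 0))) refl

⟪⟫-zero : ∀ c → ⟪ (0ʰ , c) , (c , 0ʰ) ⟫ ≡ 0ʰ
⟪⟫-zero c = ℍ-identity ⟨ c ⟩ E.⟪ (E.0ʰ , var 0) , (var 0 , E.0ʰ) ⟫ E.0ʰ refl

⟪⟫-shear : ∀ a c b d t → ⟪ (a , c -ʰ a *ʰ t) , (b , d) ⟫ ≡ ⟪ (a , c) , (b -ʰ d *ʰ conjʰ t , d) ⟫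
⟪⟫-shear a c b d t = ℍ-identity (⟨ a ⟩ ++ ⟨ c ⟩ ++ ⟨ b ⟩ ++ ⟨ d ⟩ ++ ⟨ t ⟩)
  E.⟪ (var 0 , var 1 E.-ʰ var 0 E.*ʰ var 4) , (var 2 , var 3) ⟫
  E.⟪ (var 0 , var 1) , (var 2 E.-ʰ var 3 E.*ʰ E.conjʰ (var 4) , var 3) ⟫ refl

∣_∣² : ℤ → ℕ
∣ x ∣² = ℤ.∣ x ∣ ℕ.* ℤ.∣ x ∣

‖_‖ : ℍ → ℕ
‖ ((a , b) , (c , d)) ‖ = (∣ a ∣² ℕ.+ ∣ b ∣²) ℕ.+ (∣ c ∣² ℕ.+ ∣ d ∣²)

+∣x∣²≡x*x : ∀ x → + ∣ x ∣² ≡ x ℤ.* x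
+∣x∣²≡x*x (+ n) = ℤ.pos-* n n
+∣x∣²≡x*x ℤ.-[1+ n ] = refl

∣x∣²≡0⇒x≡0 : ∀ x → ∣ x ∣² ≡ 0 → x ≡ 0ℤ
∣x∣²≡0⇒x≡0 x ∣x∣²≡0 = ℤ.∣i∣≡0⇒i≡0 (reduce (ℕ.m*n≡0⇒m≡0∨n≡0 ℤ.∣ x ∣ ∣x∣²≡0))

+‖x‖≡N : ∀ x → + ‖ x ‖ ≡ N x
+‖x‖≡N ((a , b) , (c , d)) =
  trans (ℤ.pos-+ (∣ a ∣² ℕ.+ ∣ b ∣²) _) (cong₂ ℤ._+_ (+sum-of-squares a b) (+sum-of-squares c d))
  where
  +sum-of-squares : ∀ x y → + (∣ x ∣² ℕ.+ ∣ y ∣²) ≡ x ℤ.* x ℤ.+ y ℤ.* y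
  +sum-of-squares x y = trans (ℤ.pos-+ ∣ x ∣² ∣ y ∣²) (cong₂ ℤ._+_ (+∣x∣²≡x*x x) (+∣x∣²≡x*x y))

N≡⇒‖‖≡ : ∀ x y → N x ≡ N y → ‖ x ‖ ≡ ‖ y ‖
N≡⇒‖‖≡ x y Nx≡Ny = ℤ.+-injective (trans (+‖x‖≡N x) (trans Nx≡Ny (sym (+‖x‖≡N y))))

‖‖-* : ∀ x y → ‖ x *ʰ y ‖ ≡ ‖ x ‖ ℕ.* ‖ y ‖
‖‖-* x y = ℤ.+-injective (begin
  + ‖ x *ʰ y ‖              ≡⟨ +‖x‖≡N (x *ʰ y) ⟩
  N (x *ʰ y)                ≡⟨ N-* x y ⟩
  N x ℤ.* N y               ≡⟨ cong₂ ℤ._*_ (+‖x‖≡N x) (+‖x‖≡N y) ⟨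
  + ‖ x ‖ ℤ.* + ‖ y ‖       ≡⟨ ℤ.pos-* ‖ x ‖ ‖ y ‖ ⟨
  + (‖ x ‖ ℕ.* ‖ y ‖)       ∎)
  where open ≡-Reasoning

‖‖-conj : ∀ x → ‖ conjʰ x ‖ ≡ ‖ x ‖
‖‖-conj x = N≡⇒‖‖≡ (conjʰ x) x (N-conj x)

‖‖-neg : ∀ x → ‖ -ʰ x ‖ ≡ ‖ x ‖
‖‖-neg x = N≡⇒‖‖≡ (-ʰ x) x (N-neg x)

‖x‖≡0⇒x≡0ʰ : ∀ x → ‖ x ‖ ≡ 0 → x ≡ 0ʰ
‖x‖≡0⇒x≡0ʰ ((a , b) , (c , d)) ‖x‖≡0 =
  cong₂ _,_ (cong₂ _,_ (∣x∣²≡0⇒x≡0 a (ℕ.m+n≡0⇒m≡0 _ ab≡0)) (∣x∣²≡0⇒x≡0 b (ℕ.m+n≡0⇒n≡0 _ ab≡0)))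
            (cong₂ _,_ (∣x∣²≡0⇒x≡0 c (ℕ.m+n≡0⇒m≡0 _ cd≡0)) (∣x∣²≡0⇒x≡0 d (ℕ.m+n≡0⇒n≡0 _ cd≡0)))
  where
  ab≡0 : ∣ a ∣² ℕ.+ ∣ b ∣² ≡ 0
  ab≡0 = ℕ.m+n≡0⇒m≡0 _ ‖x‖≡0
  cd≡0 : ∣ c ∣² ℕ.+ ∣ d ∣² ≡ 0
  cd≡0 = ℕ.m+n≡0⇒n≡0 (∣ a ∣² ℕ.+ ∣ b ∣²) ‖x‖≡0

twice-[n∸r]≤n : ∀ {n r} → r ≤ n → n ≤ r ℕ.+ r → (n ℕ.∸ r) ℕ.+ (n ℕ.∸ r) ≤ n
twice-[n∸r]≤n {n} {r} r≤n n≤r+r = begin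
  (n ℕ.∸ r) ℕ.+ (n ℕ.∸ r) ≤⟨ ℕ.+-monoˡ-≤ (n ℕ.∸ r) (ℕ.m≤n+o⇒m∸n≤o n r n≤r+r) ⟩
  r ℕ.+ (n ℕ.∸ r)         ≡⟨ ℕ.m+[n∸m]≡n r≤n ⟩
  n                       ∎
  where open ℕ.≤-Reasoning

round : ∀ x n .{{_ : NonZero n}} →
        Σ ℤ λ q → Σ ℤ λ r → x ≡ + n ℤ.* q ℤ.+ r × ℤ.∣ r ∣ ℕ.+ ℤ.∣ r ∣ ≤ n
round x n with x %ℕ n ℕ.+ x %ℕ n ℕ.≤? n
... | yes r+r≤n = x /ℕ n , + (x %ℕ n) ,
                  trans (a≡a%ℕn+[a/ℕn]*n x n) (floor (+ (x %ℕ n)) (x /ℕ n) (+ n)) , r+r≤n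
  where
  floor : ∀ r q m → r ℤ.+ q ℤ.* m ≡ m ℤ.* q ℤ.+ r
  floor = solve-∀
... | no r+r≰n = x /ℕ n ℤ.+ 1ℤ , + (x %ℕ n) ℤ.- + n ,
                 trans (a≡a%ℕn+[a/ℕn]*n x n) (ceiling (+ (x %ℕ n)) (x /ℕ n) (+ n)) ,
                 subst (λ k → k ℕ.+ k ≤ n) (sym ∣r-n∣≡n∸r)
                       (twice-[n∸r]≤n (ℕ.<⇒≤ r<n) (ℕ.<⇒≤ (ℕ.≰⇒> r+r≰n)))
  where
  ceiling : ∀ r q m → r ℤ.+ q ℤ.* m ≡ m ℤ.* (q ℤ.+ 1ℤ) ℤ.+ (r ℤ.- m)
  ceiling = solve-∀
  r<n : x %ℕ n < n
  r<n = n%ℕd<d x n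
  ∣r-n∣≡n∸r : ℤ.∣ + (x %ℕ n) ℤ.- + n ∣ ≡ n ℕ.∸ x %ℕ n
  ∣r-n∣≡n∸r = trans (cong ℤ.∣_∣ (ℤ.m-n≡m⊖n (x %ℕ n) n)) (ℤ.∣⊖∣-< r<n)

4∣r∣²≤n² : ∀ r {n} → ℤ.∣ r ∣ ℕ.+ ℤ.∣ r ∣ ≤ n → 4 ℕ.* ∣ r ∣² ≤ n ℕ.* n
4∣r∣²≤n² r 2∣r∣≤n = ℕ.≤-trans (ℕ.≤-reflexive (four-squares ℤ.∣ r ∣)) (ℕ.*-mono-≤ 2∣r∣≤n 2∣r∣≤n)
  where
  four-squares : ∀ k → 4 ℕ.* (k ℕ.* k) ≡ (k ℕ.+ k) ℕ.* (k ℕ.+ k)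
  four-squares = ℕ-solve-∀

sum-of-quarters≤ : ∀ a b c d {m} → 4 ℕ.* a ≤ m → 4 ℕ.* b ≤ m → 4 ℕ.* c ≤ m → 4 ℕ.* d ≤ m →
                   (a ℕ.+ b) ℕ.+ (c ℕ.+ d) ≤ m
sum-of-quarters≤ a b c d {m} a≤ b≤ c≤ d≤ = ℕ.*-cancelˡ-≤ 4 (begin
  4 ℕ.* ((a ℕ.+ b) ℕ.+ (c ℕ.+ d))                         ≡⟨ distrib a b c d ⟩
  (4 ℕ.* a ℕ.+ 4 ℕ.* b) ℕ.+ (4 ℕ.* c ℕ.+ 4 ℕ.* d)         ≤⟨ ℕ.+-mono-≤ (ℕ.+-mono-≤ a≤ b≤) (ℕ.+-mono-≤ c≤ d≤) ⟩
  (m ℕ.+ m) ℕ.+ (m ℕ.+ m)                                 ≡⟨ collect m ⟩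
  4 ℕ.* m                                                 ∎)
  where
  open ℕ.≤-Reasoning
  distrib : ∀ a b c d → 4 ℕ.* ((a ℕ.+ b) ℕ.+ (c ℕ.+ d)) ≡ (4 ℕ.* a ℕ.+ 4 ℕ.* b) ℕ.+ (4 ℕ.* c ℕ.+ 4 ℕ.* d)
  distrib = ℕ-solve-∀
  collect : ∀ m → (m ℕ.+ m) ℕ.+ (m ℕ.+ m) ≡ 4 ℕ.* m
  collect = ℕ-solve-∀

round-ℍ : ∀ s n .{{_ : NonZero n}} → Σ ℍ λ t → Σ ℍ λ r → s ≡ + n ∙ t +ʰ r × ‖ r ‖ ≤ n ℕ.* n
round-ℍ ((s₀ , s₁) , (s₂ , s₃)) n with round s₀ n | round s₁ n | round s₂ n | round s₃ n
... | q₀ , r₀ , s₀≡ , r₀≤ | q₁ , r₁ , s₁≡ , r₁≤ | q₂ , r₂ , s₂≡ , r₂≤ | q₃ , r₃ , s₃≡ , r₃≤ =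
  ((q₀ , q₁) , (q₂ , q₃)) , ((r₀ , r₁) , (r₂ , r₃)) ,
  cong₂ _,_ (cong₂ _,_ s₀≡ s₁≡) (cong₂ _,_ s₂≡ s₃≡) ,
  sum-of-quarters≤ ∣ r₀ ∣² ∣ r₁ ∣² ∣ r₂ ∣² ∣ r₃ ∣²
    (4∣r∣²≤n² r₀ r₀≤) (4∣r∣²≤n² r₁ r₁≤) (4∣r∣²≤n² r₂ r₂≤) (4∣r∣²≤n² r₃ r₃≤)

ā*[c-a*t]≡remainder : ∀ a c t r → conjʰ a *ʰ c ≡ + ‖ a ‖ ∙ t +ʰ r → conjʰ a *ʰ (c -ʰ a *ʰ t) ≡ r
ā*[c-a*t]≡remainder a c t r āc≡nt+r = begin
  conjʰ a *ʰ (c -ʰ a *ʰ t)           ≡⟨ ā*[c-a*t]≡ā*c-Na∙t a c t ⟩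
  conjʰ a *ʰ c -ʰ N a ∙ t            ≡⟨ cong₂ (λ s m → s -ʰ m ∙ t) (sym āc≡nt+r) (+‖x‖≡N a) ⟨
  (+ ‖ a ‖ ∙ t +ʰ r) -ʰ + ‖ a ‖ ∙ t  ≡⟨ +ʰ-cancelˡ (+ ‖ a ‖ ∙ t) r ⟩
  r                                  ∎
  where open ≡-Reasoning

division : ∀ a c → 0 < ‖ a ‖ → Σ ℍ λ t → ‖ c -ʰ a *ʰ t ‖ ≤ ‖ a ‖
division a c 0<‖a‖ =
  let instance _ = ℕ.>-nonZero 0<‖a‖
      t , r , āc≡nt+r , ‖r‖≤n² = round-ℍ (conjʰ a *ʰ c) ‖ a ‖
  in t , ℕ.*-cancelˡ-≤ (‖ a ‖) (begin
    ‖ a ‖ ℕ.* ‖ c -ʰ a *ʰ t ‖        ≡⟨ cong (ℕ._* ‖ c -ʰ a *ʰ t ‖) (‖‖-conj a) ⟨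
    ‖ conjʰ a ‖ ℕ.* ‖ c -ʰ a *ʰ t ‖  ≡⟨ ‖‖-* (conjʰ a) (c -ʰ a *ʰ t) ⟨
    ‖ conjʰ a *ʰ (c -ʰ a *ʰ t) ‖     ≡⟨ cong ‖_‖ (ā*[c-a*t]≡remainder a c t r āc≡nt+r) ⟩
    ‖ r ‖                            ≤⟨ ‖r‖≤n² ⟩
    ‖ a ‖ ℕ.* ‖ a ‖                  ∎)
  where open ℕ.≤-Reasoning

orthogonal-norm : ∀ a c b d → 0 < ‖ a ‖ → ⟪ (a , c) , (b , d) ⟫ ≡ 0ʰ → ‖ d ‖ ≡ ‖ a ‖ → ‖ b ‖ ≡ ‖ c ‖
orthogonal-norm a c b d 0<‖a‖ orth ‖d‖≡‖a‖ =
  ℕ.*-cancelʳ-≡ (‖ b ‖) (‖ c ‖) (‖ a ‖) {{ℕ.>-nonZero 0<‖a‖}} (begin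
  ‖ b ‖ ℕ.* ‖ a ‖                ≡⟨ ‖x*ȳ‖ b a ⟨
  ‖ b *ʰ conjʰ a ‖               ≡⟨ cong ‖_‖ (+ʰ≡0ʰ⇒≡-ʰ (b *ʰ conjʰ a) (d *ʰ conjʰ c) orth) ⟩
  ‖ -ʰ (d *ʰ conjʰ c) ‖          ≡⟨ ‖‖-neg (d *ʰ conjʰ c) ⟩
  ‖ d *ʰ conjʰ c ‖               ≡⟨ ‖x*ȳ‖ d c ⟩
  ‖ d ‖ ℕ.* ‖ c ‖                ≡⟨ cong (ℕ._* ‖ c ‖) ‖d‖≡‖a‖ ⟩
  ‖ a ‖ ℕ.* ‖ c ‖                ≡⟨ ℕ.*-comm (‖ a ‖) (‖ c ‖) ⟩
  ‖ c ‖ ℕ.* ‖ a ‖                ∎)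
  where
  open ≡-Reasoning
  ‖x*ȳ‖ : ∀ x y → ‖ x *ʰ conjʰ y ‖ ≡ ‖ x ‖ ℕ.* ‖ y ‖
  ‖x*ȳ‖ x y = trans (‖‖-* x (conjʰ y)) (cong (‖ x ‖ ℕ.*_) (‖‖-conj y))

Complement : ℍ → ℍ → Set
Complement a c = ∃₂ λ b d → ⟪ (a , c) , (b , d) ⟫ ≡ 0ʰ × ‖ b ‖ ≡ ‖ c ‖ × ‖ d ‖ ≡ ‖ a ‖

complement-swap : ∀ {a c} → Complement a c → Complement c a
complement-swap {a} {c} (b , d , orth , ‖b‖≡‖c‖ , ‖d‖≡‖a‖) =
  d , b , trans (+ʰ-comm (d *ʰ conjʰ c) (b *ʰ conjʰ a)) orth , ‖d‖≡‖a‖ , ‖b‖≡‖c‖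

complement-of-equal-norms : ∀ a c → ‖ a ‖ ≡ ‖ c ‖ → Complement a c
complement-of-equal-norms a c ‖a‖≡‖c‖ = -ʰ a , c , orth , trans (‖‖-neg a) ‖a‖≡‖c‖ , sym ‖a‖≡‖c‖
  where
  orth : ⟪ (a , c) , (-ʰ a , c) ⟫ ≡ 0ʰ
  orth = begin
    ⟪ (a , c) , (-ʰ a , c) ⟫  ≡⟨ ⟪⟫-neg a c ⟩
    real (N c ℤ.- N a)        ≡⟨ cong (λ m → real (m ℤ.- N a)) Nc≡Na ⟩
    real (N a ℤ.- N a)        ≡⟨ cong real (ℤ.+-inverseʳ (N a)) ⟩
    0ʰ                        ∎
    where
    open ≡-Reasoning
    Nc≡Na : N c ≡ N a
    Nc≡Na = trans (sym (+‖x‖≡N c)) (trans (cong +_ (sym ‖a‖≡‖c‖)) (+‖x‖≡N a))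

complement-of-zero : ∀ a c → ‖ a ‖ ≡ 0 → Complement a c
complement-of-zero a c ‖a‖≡0 =
  subst (λ a → Complement a c) (sym (‖x‖≡0⇒x≡0ʰ a ‖a‖≡0)) (c , 0ʰ , ⟪⟫-zero c , refl , refl)

complement-lift : ∀ a c t → 0 < ‖ a ‖ → Complement a (c -ʰ a *ʰ t) → Complement a c
complement-lift a c t 0<‖a‖ (b , d , orth , _ , ‖d‖≡‖a‖) =
  b -ʰ d *ʰ conjʰ t , d , orth′ ,
  orthogonal-norm a c (b -ʰ d *ʰ conjʰ t) d 0<‖a‖ orth′ ‖d‖≡‖a‖ , ‖d‖≡‖a‖
  where
  orth′ : ⟪ (a , c) , (b -ʰ d *ʰ conjʰ t , d) ⟫ ≡ 0ʰ
  orth′ = trans (sym (⟪⟫-shear a c b d t)) orth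

descend : ∀ a c → ‖ a ‖ < ‖ c ‖ → (∀ c′ → ‖ c′ ‖ < ‖ c ‖ → Complement a c′) → Complement a c
descend a c ‖a‖<‖c‖ rec with ‖ a ‖ ℕ.≟ 0
... | yes ‖a‖≡0 = complement-of-zero a c ‖a‖≡0
... | no ‖a‖≢0 =
  let 0<‖a‖ = ℕ.n≢0⇒n>0 ‖a‖≢0
      t , ‖c-at‖≤‖a‖ = division a c 0<‖a‖
  in complement-lift a c t 0<‖a‖ (rec (c -ʰ a *ʰ t) (ℕ.≤-<-trans ‖c-at‖≤‖a‖ ‖a‖<‖c‖))

complement : ∀ a c → Complement a c
complement a c = go a c (<-wellFounded (‖ a ‖ ℕ.+ ‖ c ‖))
  where
  go : ∀ a c → Acc _<_ (‖ a ‖ ℕ.+ ‖ c ‖) → Complement a c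
  go a c (acc rec) with ℕ.<-cmp ‖ a ‖ ‖ c ‖
  ... | tri≈ _ ‖a‖≡‖c‖ _ = complement-of-equal-norms a c ‖a‖≡‖c‖
  ... | tri< ‖a‖<‖c‖ _ _ =
    descend a c ‖a‖<‖c‖ λ c′ ‖c′‖<‖c‖ → go a c′ (rec (ℕ.+-monoʳ-< ‖ a ‖ ‖c′‖<‖c‖))
  ... | tri> _ _ ‖c‖<‖a‖ = complement-swap (descend c a ‖c‖<‖a‖ λ a′ ‖a′‖<‖a‖ →
    complement-swap (go a′ c (rec (ℕ.+-monoˡ-< ‖ c ‖ ‖a′‖<‖a‖))))

frame : ℍ × ℍ → ℍ × ℍ → Matᵍ 4 4
frame u v 0F = col u
frame u v 1F = col (J₂ u)
frame u v 2F = col v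
frame u v 3F = col (J₂ v)

frame-isIcube : ∀ {n} u v → 0 < n →
                ⟪ u , u ⟫ ≡ real (+ n) → ⟪ v , v ⟫ ≡ real (+ n) → ⟪ u , v ⟫ ≡ 0ʰ →
                IsIcube 4 4 (frame u v) n
frame-isIcube {n} u v 0<n uu vv uv = 0<n , diagonal , off-diagonal
  where
  vu : ⟪ v , u ⟫ ≡ 0ʰ
  vu = trans (⟪⟫-conj-sym u v) (cong conjʰ uv)
  diagonal : ∀ s → frame u v s ⋆ frame u v s ≡ ι (+ n)
  diagonal 0F = trans (⋆-col-col u u) (cong proj₁ uu)
  diagonal 1F = trans (⋆-J-J u u) (cong (λ q → conjᶜ (proj₁ q)) uu)
  diagonal 2F = trans (⋆-col-col v v) (cong proj₁ vv)
  diagonal 3F = trans (⋆-J-J v v) (cong (λ q → conjᶜ (proj₁ q)) vv)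
  off-diagonal : ∀ s t → ¬ s ≡ t → frame u v s ⋆ frame u v t ≡ 0ᵍ
  off-diagonal 0F 0F s≢t = ⊥-elim (s≢t refl)
  off-diagonal 0F 1F _ = trans (⋆-col-J u u) (cong (λ q → -ᶜ conjᶜ (proj₂ q)) uu)
  off-diagonal 0F 2F _ = trans (⋆-col-col u v) (cong proj₁ uv)
  off-diagonal 0F 3F _ = trans (⋆-col-J u v) (cong (λ q → -ᶜ conjᶜ (proj₂ q)) uv)
  off-diagonal 1F 0F _ = trans (⋆-J-col u u) (cong proj₂ uu)
  off-diagonal 1F 1F s≢t = ⊥-elim (s≢t refl)
  off-diagonal 1F 2F _ = trans (⋆-J-col u v) (cong proj₂ uv)
  off-diagonal 1F 3F _ = trans (⋆-J-J u v) (cong (λ q → conjᶜ (proj₁ q)) uv)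
  off-diagonal 2F 0F _ = trans (⋆-col-col v u) (cong proj₁ vu)
  off-diagonal 2F 1F _ = trans (⋆-col-J v u) (cong (λ q → -ᶜ conjᶜ (proj₂ q)) vu)
  off-diagonal 2F 2F s≢t = ⊥-elim (s≢t refl)
  off-diagonal 2F 3F _ = trans (⋆-col-J v v) (cong (λ q → -ᶜ conjᶜ (proj₂ q)) vv)
  off-diagonal 3F 0F _ = trans (⋆-J-col v u) (cong proj₂ vu)
  off-diagonal 3F 1F _ = trans (⋆-J-J v u) (cong (λ q → conjᶜ (proj₁ q)) vu)
  off-diagonal 3F 2F _ = trans (⋆-J-col v v) (cong proj₂ vv)
  off-diagonal 3F 3F s≢t = ⊥-elim (s≢t refl)

col-split : ∀ (v : Vecᵍ 4) j → col ((v 0F , v 1F) , (v 2F , v 3F)) j ≡ v j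
col-split v 0F = refl
col-split v 1F = refl
col-split v 2F = refl
col-split v 3F = refl

⟪⟫-self-‖‖ : ∀ a c → ⟪ (a , c) , (a , c) ⟫ ≡ real (+ (‖ a ‖ ℕ.+ ‖ c ‖))
⟪⟫-self-‖‖ a c = trans (⟪⟫-self a c)
  (cong real (sym (trans (ℤ.pos-+ (‖ a ‖) (‖ c ‖)) (cong₂ ℤ._+_ (+‖x‖≡N a) (+‖x‖≡N c)))))

nonzero⇒0<norm : ∀ a c → Nonzero (col (a , c)) → 0 < ‖ a ‖ ℕ.+ ‖ c ‖
nonzero⇒0<norm a c u≢0 = ℕ.n≢0⇒n>0 λ n≡0 →
  u≢0 (col-zero (‖x‖≡0⇒x≡0ʰ a (ℕ.m+n≡0⇒m≡0 (‖ a ‖) n≡0))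
                (‖x‖≡0⇒x≡0ʰ c (ℕ.m+n≡0⇒n≡0 (‖ a ‖) n≡0)))
  where
  col-zero : ∀ {a c} → a ≡ 0ʰ → c ≡ 0ʰ → ∀ j → col (a , c) j ≡ 0ᵍ
  col-zero refl refl 0F = refl
  col-zero refl refl 1F = refl
  col-zero refl refl 2F = refl
  col-zero refl refl 3F = refl

mainTheorem5 : (v : Vecᵍ 4) → Nonzero v → ExtendsVec 4 4 v
mainTheorem5 v v≢0 with complement (v 0F , v 1F) (v 2F , v 3F)
... | b , d , uw , ‖b‖≡‖c‖ , ‖d‖≡‖a‖ =
  frame u w , (n , frame-isIcube u w 0<n (⟪⟫-self-‖‖ a c) ww uw) , 0F , col-split v
  where
  a c : ℍ
  a = (v 0F , v 1F)
  c = (v 2F , v 3F)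
  u w : ℍ × ℍ
  u = (a , c)
  w = (b , d)
  n : ℕ
  n = ‖ a ‖ ℕ.+ ‖ c ‖
  0<n : 0 < n
  0<n = nonzero⇒0<norm a c λ col≡0 → v≢0 λ j → trans (sym (col-split v j)) (col≡0 j)
  ww : ⟪ w , w ⟫ ≡ real (+ n)
  ww = trans (⟪⟫-self-‖‖ b d)
             (cong (λ m → real (+ m)) (trans (cong₂ ℕ._+_ ‖b‖≡‖c‖ ‖d‖≡‖a‖) (ℕ.+-comm (‖ c ‖) (‖ a ‖))))
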